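{- Let $G$ be a connected cubic graph, $F$ a $1$-factor of $G$ and $X=G/F$. Then $X$ admits a decomposition of its edge set into a blue $2$-factor and a red $2$-factor such that the traversing transitions are exactly the color-switching transitions and the non-traversing transitions are exactly the color-preserving transitions if and only if $F$ is special.
   Context: Let $Y=G-F$. $X=G/F$ is obtained by contracting each edge $e=uv\in F$ to a vertex $x_e$; its edges are the edges of $Y$, and the four edge-ends at $x_e$ correspond to the edge-ends of $Y$ at $u$ and $v$. A transition at $x_e$ is an unordered pair of distinct edge-ends at $x_e$; non-traversing if both come from the same end of $e$, traversing otherwise. A transition is color-switching if its two edge-ends belong to edges of different colors and color-preserving otherwise. The auxiliary graph $Y(G,F)$ has the cycles of $Y$ as vertices, two of them adjacent iff joined by at least one edge of $F$, with a loop at a cycle if some edge of $F$ is a chord of that cycle. $F$ is special if $Y(G,F)$ is bipartite (in particular loopless). -}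

module Defs where

open import Data.Nat using (ℕ)
open import Data.Bool using (Bool; true; false; not; _∧_; _∨_)
open import Data.Fin using (Fin; zero; suc)
open import Data.Fin.Properties using (_≟_)
open import Data.List using (List; length; filterᵇ; allFin; cartesianProduct)
open import Data.Product using (Σ; _×_; _,_; proj₁; proj₂; ∃; ∃-syntax)
open import Function.Bundles using (_⇔_)
open import Relation.Nullary using (¬_; does)
open import Relation.Binary.PropositionalEquality using (_≡_; _≢_)

-- A finite multigraph (loops and parallel edges allowed):
-- vertices Fin nV, edges Fin nE, edge e has ends (e , 0) and (e , 1)
-- located at the vertices endpt e 0 and endpt e 1.
record Graph : Set where
  field
    nV : ℕ
    nE : ℕ
    endpt : Fin nE → Fin 2 → Fin nV

module _ (G : Graph) where
  open Graph G

  End : Set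
  End = Fin nE × Fin 2

  edgeOf : End → Fin nE
  edgeOf = proj₁

  vtx : End → Fin nV
  vtx (e , i) = endpt e i

  allEnds : List End
  allEnds = cartesianProduct (allFin nE) (allFin 2)

  countEnds : (End → Bool) → ℕ
  countEnds p = length (filterᵇ p allEnds)

  _==_ : Fin nV → Fin nV → Bool
  u == v = does (u ≟ v)

  -- degree of v in the spanning subgraph with edge set S (loops count twice)
  degIn : (Fin nE → Bool) → Fin nV → ℕ
  degIn S v = countEnds (λ a → S (edgeOf a) ∧ (vtx a == v))

  Cubic : Set
  Cubic = ∀ v → degIn (λ _ → true) v ≡ 3

  data Reach (S : Fin nE → Bool) : Fin nV → Fin nV → Set where
    here : ∀ {v} → Reach S v v
    step : ∀ {u w} (e : Fin nE) (i : Fin 2) → S e ≡ true → endpt e i ≡ u →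
           Reach S (endpt e (Data.Fin.opposite i)) w → Reach S u w

  Connected : Set
  Connected = ∀ u v → Reach (λ _ → true) u v

  IsOneFactor : (Fin nE → Bool) → Set
  IsOneFactor F = ∀ v → degIn F v ≡ 1

  module _ (F : Fin nE → Bool) where

    InY : Fin nE → Bool
    InY e = not (F e)

    -- X = G/F : vertices x_f for f ∈ F, edges = edges of Y.
    -- An edge-end a of Y lies at x_f iff its G-vertex is an end of f.
    AtX : Fin nE → End → Set
    AtX f a = InY (edgeOf a) ≡ true × ∃[ j ] vtx a ≡ endpt f j

    atXᵇ : Fin nE → End → Bool
    atXᵇ f a = InY (edgeOf a) ∧ ((vtx a == endpt f zero) ∨ (vtx a == endpt f (suc zero)))

    degX : (Fin nE → Bool) → Fin nE → ℕ
    degX C f = countEnds (λ a → C (edgeOf a) ∧ atXᵇ f a)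

    -- col e ≡ true : blue, col e ≡ false : red (only relevant on edges of Y).
    -- The blue edges and the red edges each form a 2-factor of X.
    BlueRed2Factors : (Fin nE → Bool) → Set
    BlueRed2Factors col = ∀ f → F f ≡ true →
      degX col f ≡ 2 × degX (λ e → not (col e)) f ≡ 2

    -- transitions at x_f: pairs of distinct edge-ends at x_f
    NonTraversing : Fin nE → End → End → Set
    NonTraversing f a b = ∃[ j ] (vtx a ≡ endpt f j × vtx b ≡ endpt f j)

    Traversing : Fin nE → End → End → Set
    Traversing f a b = ¬ NonTraversing f a b

    ColourSwitching : (Fin nE → Bool) → End → End → Set
    ColourSwitching col a b = col (edgeOf a) ≢ col (edgeOf b)

    ColourPreserving : (Fin nE → Bool) → End → End → Set
    ColourPreserving col a b = col (edgeOf a) ≡ col (edgeOf b)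

    TransitionCondition : (Fin nE → Bool) → Set
    TransitionCondition col = ∀ f → F f ≡ true → ∀ a b → a ≢ b → AtX f a → AtX f b →
      (Traversing f a b ⇔ ColourSwitching col a b) ×
      (NonTraversing f a b ⇔ ColourPreserving col a b)

    -- Y(G,F): vertices are the cycles (= connected components) of Y; a
    -- 2-colouring of its vertices is a colouring of V(G) constant on
    -- components of Y.  Bipartite (hence loopless): every edge of F joins
    -- differently coloured cycles.
    Special : Set
    Special = Σ (Fin nV → Bool) λ c →
      (∀ u v → Reach InY u v → c u ≡ c v) ×
      (∀ f → F f ≡ true → c (endpt f zero) ≢ c (endpt f (suc zero)))

module Submission where

-- A blue/red colouring of the edges of Y = G - F satisfying
-- the transition condition is the same thing as a 2-colouring of V(G) that is
-- constant on the cycles of Y and differs at the two ends of every edge of F.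
--
-- (⇒) At a vertex x of G the two Y-edges meet in a non-traversing transition,
-- so they have the same colour; this defines a colour of x, which is constant
-- along Y-edges and hence on the components of Y.  An edge f = uv of F is not
-- a loop (F is a 1-factor), so a Y-end at u and a Y-end at v form a traversing
-- transition at x_f, and therefore u and v get different colours.
-- (⇐) Colour each Y-edge by the colour of its endpoints.  Two Y-ends at x_f
-- have the same colour iff they sit at the same end of f, because the two ends
-- of f are coloured differently; this is the transition condition.  The blue
-- (red) edges at x_f are exactly the two Y-edges at the blue (red) end of f, so
-- both colour classes are 2-factors of X.

open import Defs
open import Data.Bool using (Bool; true; false; not; _∧_; _∨_)
open import Data.Bool.Properties using (∧-zeroʳ; ∧-identityʳ; ∨-comm; not-injective)
open import Data.Empty using (⊥-elim)
open import Data.Fin using (Fin; zero; suc; opposite)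
open import Data.Fin.Properties using (_≟_)
open import Data.List using (List; []; _∷_; length; filterᵇ)
open import Data.List.Membership.Propositional using (_∈_)
open import Data.List.Membership.Propositional.Properties using (∈-cartesianProduct⁺; ∈-allFin)
open import Data.List.Relation.Unary.Any using (here; there)
open import Data.Nat using (ℕ; suc; _+_; _≤_; s≤s; z≤n)
open import Data.Nat.Properties using (+-suc; suc-injective; n≤1+n; ≤-refl; ≤-trans)
open import Data.Product using (Σ; _×_; _,_; proj₁; proj₂; ∃-syntax)
open import Data.Product.Properties using (≡-dec)
open import Function using (_∘_)
open import Function.Bundles using (_⇔_; mk⇔; Equivalence)
open import Relation.Nullary using (¬_; yes; no)
open import Relation.Nullary.Decidable using (dec-true)
open import Relation.Binary.PropositionalEquality

¬-⇔ : {A B : Set} → A ⇔ B → (¬ A) ⇔ (¬ B)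
¬-⇔ A⇔B = mk⇔ (λ ¬a b → ¬a (Equivalence.from A⇔B b)) (λ ¬b a → ¬b (Equivalence.to A⇔B a))

∧-true⁻ : ∀ {x y} → x ∧ y ≡ true → x ≡ true × y ≡ true
∧-true⁻ {true} y≡true = refl , y≡true

count : {A : Set} → (A → Bool) → List A → ℕ
count p xs = length (filterᵇ p xs)

module _ {A : Set} where

  count-split : (p q : A → Bool) (xs : List A) →
    count p xs ≡ count (λ x → q x ∧ p x) xs + count (λ x → not (q x) ∧ p x) xs
  count-split p q [] = refl
  count-split p q (x ∷ xs) with p x | q x
  ... | true  | true  = cong suc (count-split p q xs)
  ... | true  | false = trans (cong suc (count-split p q xs)) (sym (+-suc _ _))
  ... | false | true  = count-split p q xs
  ... | false | false = count-split p q xs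

  count-cong : {p q : A → Bool} → (∀ x → p x ≡ q x) → (xs : List A) → count p xs ≡ count q xs
  count-cong p≗q [] = refl
  count-cong {p} {q} p≗q (x ∷ xs) with p x | q x | p≗q x
  ... | true  | .true  | refl = cong suc (count-cong p≗q xs)
  ... | false | .false | refl = count-cong p≗q xs

  count-witness : (p : A → Bool) (xs : List A) {n : ℕ} → count p xs ≡ suc n →
    Σ A λ a → p a ≡ true
  count-witness p [] ()
  count-witness p (x ∷ xs) count≡suc with p x in px
  ... | true  = x , px
  ... | false = count-witness p xs count≡suc

  count-∷ : (p : A → Bool) (z : A) (xs : List A) → count p xs ≤ count p (z ∷ xs)
  count-∷ p z xs with p z
  ... | true  = n≤1+n _
  ... | false = ≤-refl

  count-member : (p : A → Bool) {x : A} {xs : List A} → x ∈ xs → p x ≡ true → 1 ≤ count p xs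
  count-member p {x} {x ∷ xs} (here refl) px rewrite px = s≤s z≤n
  count-member p {x} {z ∷ xs} (there x∈xs) px = ≤-trans (count-member p x∈xs px) (count-∷ p z xs)

  count-two : (p : A → Bool) {x y : A} {xs : List A} → x ∈ xs → y ∈ xs → x ≢ y →
    p x ≡ true → p y ≡ true → 2 ≤ count p xs
  count-two p (here refl) (here refl) x≢y _ _ = ⊥-elim (x≢y refl)
  count-two p {x} {y} {x ∷ xs} (here refl) (there y∈xs) _ px py rewrite px =
    s≤s (count-member p y∈xs py)
  count-two p {x} {y} {y ∷ xs} (there x∈xs) (here refl) _ px py rewrite py =
    s≤s (count-member p x∈xs px)
  count-two p {xs = z ∷ xs} (there x∈xs) (there y∈xs) x≢y px py =
    ≤-trans (count-two p x∈xs y∈xs x≢y px py) (count-∷ p z xs)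

module GraphFacts (G : Graph) where
  open Graph G

  _≡ᵇ_ : Fin nV → Fin nV → Bool
  _≡ᵇ_ = _==_ G

  ≡ᵇ-sound : ∀ {u v} → u ≡ᵇ v ≡ true → u ≡ v
  ≡ᵇ-sound {u} {v} u≡ᵇv with u ≟ v
  ... | yes u≡v = u≡v
  ≡ᵇ-sound () | no _

  ≡ᵇ-refl : ∀ u → u ≡ᵇ u ≡ true
  ≡ᵇ-refl u = dec-true (u ≟ u) refl

  every-end-listed : (a : End G) → a ∈ allEnds G
  every-end-listed (e , i) = ∈-cartesianProduct⁺ (∈-allFin e) (∈-allFin i)

  reach-invariant : {A : Set} {S : Fin nE → Bool} (c : Fin nV → A) →
    (∀ e i → S e ≡ true → c (endpt e i) ≡ c (endpt e (opposite i))) →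
    ∀ {u w} → Reach G S u w → c u ≡ c w
  reach-invariant c agree here = refl
  reach-invariant c agree (step e i Se refl u⇝w) = trans (agree e i Se) (reach-invariant c agree u⇝w)

  select-first : (g : Fin nV → Bool) (u v : Fin nV) → g u ≡ true → g v ≡ false →
    ∀ x → g x ∧ (x ≡ᵇ u ∨ x ≡ᵇ v) ≡ x ≡ᵇ u
  select-first g u v gu gv x with x ≟ u | x ≟ v
  ... | yes refl | _        = trans (∧-identityʳ (g u)) gu
  ... | no _     | yes refl = trans (∧-identityʳ (g v)) gv
  ... | no _     | no _     = ∧-zeroʳ (g x)

  select : (g : Fin nV → Bool) (u v : Fin nV) → g u ≢ g v →
    Σ (Fin nV) λ w → ∀ x → g x ∧ (x ≡ᵇ u ∨ x ≡ᵇ v) ≡ x ≡ᵇ w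
  select g u v gu≢gv with g u in gu | g v in gv
  ... | true  | true  = ⊥-elim (gu≢gv refl)
  ... | false | false = ⊥-elim (gu≢gv refl)
  ... | true  | false = u , select-first g u v gu gv
  ... | false | true  = v , λ x →
    trans (cong (g x ∧_) (∨-comm (x ≡ᵇ u) (x ≡ᵇ v))) (select-first g v u gv gu x)

module CubicWithOneFactor (G : Graph) (F : Fin (Graph.nE G) → Bool)
                          (cubic : Cubic G) (oneFactor : IsOneFactor G F) where
  open Graph G
  open GraphFacts G

  IsYEnd : End G → Set
  IsYEnd a = InY G F (edgeOf G a) ≡ true

  -- Y is 2-regular: the three edge-ends at v are one F-end and two Y-ends.
  degY : ∀ v → degIn G (InY G F) v ≡ 2
  degY v = suc-injective (begin
    1 + degIn G (InY G F) v                 ≡⟨ cong (_+ degIn G (InY G F) v) (sym (oneFactor v)) ⟩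
    degIn G F v + degIn G (InY G F) v       ≡⟨ sym (count-split _ (F ∘ edgeOf G) (allEnds G)) ⟩
    degIn G (λ _ → true) v                  ≡⟨ cubic v ⟩
    3                                       ∎)
    where open ≡-Reasoning

  Y-end-at : ∀ v → Σ (End G) λ a → IsYEnd a × vtx G a ≡ v
  Y-end-at v with count-witness _ (allEnds G) (degY v)
  ... | a , Ya∧atv = let (Ya , atv) = ∧-true⁻ Ya∧atv in a , Ya , ≡ᵇ-sound atv

  F-edge-at : ∀ v → Σ (Fin nE) λ f → F f ≡ true × Σ (Fin 2) λ j → endpt f j ≡ v
  F-edge-at v with count-witness _ (allEnds G) (oneFactor v)
  ... | (f , j) , Ff∧atv = let (Ff , atv) = ∧-true⁻ Ff∧atv in f , Ff , j , ≡ᵇ-sound atv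

  -- An edge of F is not a loop, as it would contribute 2 to the F-degree.
  F-edge-no-loop : ∀ f → F f ≡ true → endpt f zero ≢ endpt f (suc zero)
  F-edge-no-loop f Ff u≡v = 2≰1 (subst (2 ≤_) (oneFactor u) two-F-ends)
    where
    u : Fin nV
    u = endpt f zero
    two-F-ends : 2 ≤ degIn G F u
    two-F-ends = count-two _ (every-end-listed (f , zero)) (every-end-listed (f , suc zero)) (λ ())
      (cong₂ _∧_ Ff (≡ᵇ-refl u)) (cong₂ _∧_ Ff (trans (cong (_≡ᵇ u) (sym u≡v)) (≡ᵇ-refl u)))
    2≰1 : ¬ (2 ≤ 1)
    2≰1 (s≤s ())

  module FromTransitionCondition (col : Fin nE → Bool) (tc : TransitionCondition G F col) where

    -- The two Y-ends at a vertex meet in a non-traversing transition at the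
    -- F-edge through that vertex, so their edges have the same colour.
    same-vertex-same-colour : ∀ a b → IsYEnd a → IsYEnd b → vtx G a ≡ vtx G b →
      col (edgeOf G a) ≡ col (edgeOf G b)
    same-vertex-same-colour a b Ya Yb a~b with ≡-dec _≟_ _≟_ a b | F-edge-at (vtx G a)
    ... | yes refl | _ = refl
    ... | no a≢b   | f , Ff , j , f~a =
      Equivalence.to (proj₂ (tc f Ff a b a≢b (Ya , j , sym f~a) (Yb , j , f~b))) (j , sym f~a , f~b)
      where
      f~b : vtx G b ≡ endpt f j
      f~b = trans (sym a~b) (sym f~a)

    vertex-colour : Fin nV → Bool
    vertex-colour v = col (edgeOf G (proj₁ (Y-end-at v)))

    vertex-colour-spec : ∀ a → IsYEnd a → vertex-colour (vtx G a) ≡ col (edgeOf G a)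
    vertex-colour-spec a Ya =
      let (b , Yb , b~a) = Y-end-at (vtx G a) in same-vertex-same-colour b a Yb Ya b~a

    -- Both ends of a Y-edge get its colour, so the colouring is constant on
    -- the components of Y.
    constant-on-Y : ∀ u v → Reach G (InY G F) u v → vertex-colour u ≡ vertex-colour v
    constant-on-Y u v = reach-invariant vertex-colour λ e i Ye →
      trans (vertex-colour-spec (e , i) Ye) (sym (vertex-colour-spec (e , opposite i) Ye))

    -- A Y-end at each end of an F-edge f form a traversing transition at x_f
    -- (f is not a loop), so the two ends of f are coloured differently.
    F-edges-switch : ∀ f → F f ≡ true →
      vertex-colour (endpt f zero) ≢ vertex-colour (endpt f (suc zero))
    F-edges-switch f Ff same with Y-end-at (endpt f zero) | Y-end-at (endpt f (suc zero))
    ... | a , Ya , a~u | b , Yb , b~v = colour-switch (begin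
      col (edgeOf G a)      ≡⟨ sym (vertex-colour-spec a Ya) ⟩
      vertex-colour (vtx G a) ≡⟨ cong vertex-colour a~u ⟩
      vertex-colour u       ≡⟨ same ⟩
      vertex-colour v       ≡⟨ cong vertex-colour (sym b~v) ⟩
      vertex-colour (vtx G b) ≡⟨ vertex-colour-spec b Yb ⟩
      col (edgeOf G b)      ∎)
      where
      open ≡-Reasoning
      u v : Fin nV
      u = endpt f zero
      v = endpt f (suc zero)
      a≢b : a ≢ b
      a≢b a≡b = F-edge-no-loop f Ff (trans (sym a~u) (trans (cong (vtx G) a≡b) b~v))
      traversing : Traversing G F f a b
      traversing (j , a~j , b~j) = F-edge-no-loop f Ff (trans (sym a~u) (trans a~j (trans (sym b~j) b~v)))
      colour-switch : ColourSwitching G F col a b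
      colour-switch = Equivalence.to (proj₁ (tc f Ff a b a≢b (Ya , zero , a~u) (Yb , suc zero , b~v))) traversing

    special : Special G F
    special = vertex-colour , constant-on-Y , F-edges-switch

  module FromSpecial (c : Fin nV → Bool)
                     (constant-on-Y : ∀ u v → Reach G (InY G F) u v → c u ≡ c v)
                     (F-switch : ∀ f → F f ≡ true → c (endpt f zero) ≢ c (endpt f (suc zero))) where

    col : Fin nE → Bool
    col e = c (endpt e zero)

    col-at-end : ∀ a → IsYEnd a → col (edgeOf G a) ≡ c (vtx G a)
    col-at-end (e , zero)     Ye = refl
    col-at-end (e , suc zero) Ye = constant-on-Y _ _ (step e zero Ye refl here)

    ends-coloured-apart : ∀ f → F f ≡ true → ∀ j k → c (endpt f j) ≡ c (endpt f k) → j ≡ k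
    ends-coloured-apart f Ff zero       zero       _    = refl
    ends-coloured-apart f Ff (suc zero) (suc zero) _    = refl
    ends-coloured-apart f Ff zero       (suc zero) same = ⊥-elim (F-switch f Ff same)
    ends-coloured-apart f Ff (suc zero) zero       same = ⊥-elim (F-switch f Ff (sym same))

    non-traversing⇔preserving : ∀ f → F f ≡ true → ∀ a b → AtX G F f a → AtX G F f b →
      NonTraversing G F f a b ⇔ ColourPreserving G F col a b
    non-traversing⇔preserving f Ff a b (Ya , ja , a~ja) (Yb , jb , b~jb) =
      mk⇔ same-end⇒same-colour same-colour⇒same-end
      where
      open ≡-Reasoning
      same-end⇒same-colour : NonTraversing G F f a b → ColourPreserving G F col a b
      same-end⇒same-colour (j , a~j , b~j) = begin
        col (edgeOf G a) ≡⟨ col-at-end a Ya ⟩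
        c (vtx G a)      ≡⟨ cong c (trans a~j (sym b~j)) ⟩
        c (vtx G b)      ≡⟨ sym (col-at-end b Yb) ⟩
        col (edgeOf G b) ∎
      same-colour⇒same-end : ColourPreserving G F col a b → NonTraversing G F f a b
      same-colour⇒same-end same with ends-coloured-apart f Ff ja jb (begin
        c (endpt f ja)   ≡⟨ cong c (sym a~ja) ⟩
        c (vtx G a)      ≡⟨ sym (col-at-end a Ya) ⟩
        col (edgeOf G a) ≡⟨ same ⟩
        col (edgeOf G b) ≡⟨ col-at-end b Yb ⟩
        c (vtx G b)      ≡⟨ cong c b~jb ⟩
        c (endpt f jb)   ∎)
      ... | refl = ja , a~ja , b~jb

    transition-condition : TransitionCondition G F col
    transition-condition f Ff a b _ atA atB =
      ¬-⇔ (non-traversing⇔preserving f Ff a b atA atB) , non-traversing⇔preserving f Ff a b atA atB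

    -- For a colour class selected by h (h = id: blue, h = not: red) in which
    -- exactly one end w of f lies, the h-edges at x_f are the Y-edges at w;
    -- there are two of them.
    colour-class-degree : ∀ f → F f ≡ true → (h : Bool → Bool) →
      h (c (endpt f zero)) ≢ h (c (endpt f (suc zero))) →
      countEnds G (λ a → h (col (edgeOf G a)) ∧ atXᵇ G F f a) ≡ 2
    colour-class-degree f Ff h separates =
      trans (count-cong h-ends-at-xf≡Y-ends-at-w (allEnds G)) (degY w)
      where
      u v w : Fin nV
      u = endpt f zero
      v = endpt f (suc zero)
      w = proj₁ (select (h ∘ c) u v separates)
      h-ends-at-xf≡Y-ends-at-w : ∀ a →
        h (col (edgeOf G a)) ∧ atXᵇ G F f a ≡ InY G F (edgeOf G a) ∧ (vtx G a ≡ᵇ w)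
      h-ends-at-xf≡Y-ends-at-w a with F (edgeOf G a) in Fe
      ... | true  = ∧-zeroʳ _
      ... | false = trans (cong (λ b → h b ∧ _) (col-at-end a (cong not Fe)))
                          (proj₂ (select (h ∘ c) u v separates) (vtx G a))

    -- One end of each F-edge is blue and the other red, so both colour classes
    -- have degree 2 at every vertex x_f of X.
    two-factors : BlueRed2Factors G F col
    two-factors f Ff = colour-class-degree f Ff (λ b → b) (F-switch f Ff)
                     , colour-class-degree f Ff not (F-switch f Ff ∘ not-injective)

theorem7 : (G : Graph) (F : Fin (Graph.nE G) → Bool) →
    Connected G → Cubic G → IsOneFactor G F →
    ((∃[ col ] (BlueRed2Factors G F col × TransitionCondition G F col)) ⇔ Special G F)
theorem7 G F _ cubic oneFactor = mk⇔
  (λ (col , _ , tc) → FromTransitionCondition.special col tc)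
  (λ (c , constant-on-Y , F-switch) → let open FromSpecial c constant-on-Y F-switch in
     col , two-factors , transition-condition)
  where open CubicWithOneFactor G F cubic oneFactor
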